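{- For every integer $n\ge 3$, the squid graph $Sq(2n-1;1^n)$ is not strongly nice. Moreover, its chromatic symmetric function $X_{Sq(2n-1;1^n)}$ is not Schur positive.
   Context: The squid graph $Sq(2n-1;1^n)$ is obtained from the cycle $C_{2n-1}$ on vertices $u,u_1,\ldots,u_{2n-2}$ (in cyclic order) by attaching $n$ leaves $v_1,\ldots,v_n$ to the vertex $u$. For a finite simple graph $G$ with vertex set $\{w_1,\ldots,w_d\}$, its chromatic symmetric function is $X_G=\sum_\kappa x_{\kappa(w_1)}\cdots x_{\kappa(w_d)}$, summing over all proper colorings $\kappa:V(G)\to\{1,2,\ldots\}$. For a partition $\lambda$, $m_\lambda$ and $s_\lambda$ denote the monomial symmetric function and the Schur function, and $[b_\lambda]f$ the coefficient of $b_\lambda$ in $f$. For partitions of the same integer, $\mu\le\lambda$ in dominance order means $\sum_{i=1}^k\mu_i\le\sum_{i=1}^k\lambda_i$ for all $k$. A graph $G$ is strongly nice if $[m_\mu]X_G\ge[m_\lambda]X_G$ whenever $\mu\le\lambda$ in dominance order. A symmetric function $f$ is Schur positive if $[s_\lambda]f\ge0$ for all $\lambda$. -}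

module Defs where

open import Data.Nat using (ℕ; zero; suc; _+_; _*_; _∸_; _≤_; _<_; _≡ᵇ_; _≤ᵇ_; _<ᵇ_)
open import Data.Bool using (Bool; true; false; _∧_; _∨_; not; if_then_else_)
open import Data.Fin using (Fin; toℕ)
open import Data.Vec using (Vec; []; _∷_; lookup; toList)
open import Data.List using (List; []; _∷_; [_]; length; take; map; concatMap; allFin; upTo)
open import Data.Bool.ListAction using (and)
open import Data.Nat.ListAction using (sum)
open import Data.List.Relation.Unary.All using (All)
open import Data.List.Relation.Unary.Linked using (Linked)
open import Data.Product using (Σ; _×_; _,_; ∃)
open import Relation.Binary.PropositionalEquality using (_≡_)
open import Relation.Nullary using (¬_)

allVecs : (ℓ d : ℕ) → List (Vec (Fin ℓ) d)
allVecs ℓ zero    = [ [] ]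
allVecs ℓ (suc d) = concatMap (λ i → map (i ∷_) (allVecs ℓ d)) (allFin ℓ)

all : ∀ {A : Set} → (A → Bool) → List A → Bool
all p xs = and (map p xs)

_==ᴸ_ : List ℕ → List ℕ → Bool
[]       ==ᴸ []       = true
(x ∷ xs) ==ᴸ (y ∷ ys) = (x ≡ᵇ y) ∧ (xs ==ᴸ ys)
_        ==ᴸ _        = false

-- i-th entry of a list, 0 if out of range
at : List ℕ → ℕ → ℕ
at []       _       = 0
at (x ∷ xs) zero    = x
at (x ∷ xs) (suc i) = at xs i

countVal : ∀ {ℓ d} → Vec (Fin ℓ) d → ℕ → ℕ
countVal {d = d} w c = sum (map (λ v → if toℕ (lookup w v) ≡ᵇ c then 1 else 0) (allFin d))

hasContent : (α : List ℕ) → ∀ {d} → Vec (Fin (length α)) d → Bool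
hasContent α w = map (countVal w) (upTo (length α)) ==ᴸ α

record Partition (d : ℕ) : Set where
  constructor mkPartition
  field
    parts      : List ℕ
    decreasing : Linked (λ a b → b ≤ a) parts
    positive   : All (λ a → 0 < a) parts
    total      : sum parts ≡ d
open Partition public

_⊴_ : ∀ {d} → Partition d → Partition d → Set
μ ⊴ λ′ = ∀ k → sum (take k (parts μ)) ≤ sum (take k (parts λ′))

Graph : ℕ → Set
Graph d = Fin d → Fin d → Bool

proper : ∀ {d ℓ} → Graph d → Vec (Fin ℓ) d → Bool
proper {d} G κ =
  all (λ v → all (λ w → not (G v w) ∨ not (toℕ (lookup κ v) ≡ᵇ toℕ (lookup κ w))) (allFin d)) (allFin d)

-- [m_λ] X_G = [x_1^{λ_1} ⋯ x_ℓ^{λ_ℓ}] X_G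
--           = number of proper colourings using colour i exactly λ_i times
--             (colours 1..ℓ encoded as Fin ℓ)
coeffM : ∀ {d} → Graph d → Partition d → ℕ
coeffM {d} G λ′ =
  sum (map (λ κ → if proper G κ ∧ hasContent (parts λ′) κ then 1 else 0)
           (allVecs (length (parts λ′)) d))

StronglyNice : ∀ {d} → Graph d → Set
StronglyNice G = ∀ μ λ′ → μ ⊴ λ′ → coeffM G λ′ ≤ coeffM G μ

-- A filling T of the Young diagram of shape λ (cells listed row by row,
-- cell (i,j) at position sum(take i λ) + j) with entries in {1..length μ}
-- (encoded as Fin (length μ)).
semistandard : (λ′ : List ℕ) → ∀ {ℓ d} → Vec (Fin ℓ) d → Bool
semistandard λ′ T = rowsOK ∧ colsOK
  where
  e : ℕ → ℕ → ℕ
  e i j = at (map toℕ (toList T)) (sum (take i λ′) + j)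
  rowsOK = all (λ i → all (λ j → e i j ≤ᵇ e i (suc j)) (upTo (at λ′ i ∸ 1))) (upTo (length λ′))
  colsOK = all (λ i → all (λ j → e i j <ᵇ e (suc i) j) (upTo (at λ′ (suc i)))) (upTo (length λ′ ∸ 1))

-- Kostka number K_{λμ} = number of SSYT of shape λ and content μ = [m_μ] s_λ
kostka : ∀ {d} → Partition d → Partition d → ℕ
kostka {d} λ′ μ =
  sum (map (λ T → if semistandard (parts λ′) T ∧ hasContent (parts μ) T then 1 else 0)
           (allVecs (length (parts μ)) d))

-- Equality of homogeneous degree-d symmetric functions is tested on all
-- m_μ-coefficients, μ ⊢ d.
SchurPositive : ∀ {d} → Graph d → Set
SchurPositive {d} G =
  Σ (List (Partition d × ℕ)) λ terms →
    ∀ μ → coeffM G μ ≡ sum (map (λ { (λ′ , c) → c * kostka λ′ μ }) terms)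

-- vertices: 0 = u, 1..2n-2 = u_1..u_{2n-2} (the cycle C_{2n-1} in cyclic order),
-- 2n-1 .. 3n-2 = leaves v_1..v_n attached to u.
squidSize : ℕ → ℕ
squidSize n = (2 * n ∸ 1) + n

squid : (n : ℕ) → Graph (squidSize n)
squid n a b = cyc (toℕ a) (toℕ b) ∨ cyc (toℕ b) (toℕ a) ∨ leaf (toℕ a) (toℕ b) ∨ leaf (toℕ b) (toℕ a)
  where
  m = 2 * n ∸ 1
  cyc : ℕ → ℕ → Bool
  cyc x y = ((suc x ≡ᵇ y) ∧ (y <ᵇ m)) ∨ ((x ≡ᵇ 0) ∧ (y ≡ᵇ m ∸ 1))
  leaf : ℕ → ℕ → Bool
  leaf x y = (x ≡ᵇ 0) ∧ (m ≤ᵇ y)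

{-# OPTIONS --safe #-}

-- Write n = k + 3, colour with 0, 1, 2 and compare μ₀ = (n, n, n−1) ⊴ μ₁ = (n+1, n−1, n−1).
-- In a proper colouring the colour of u occurs at most n−1 times (legs avoid it and the odd
-- cycle has independence number n−1), so colourings of content μ₀ give u the colour 2 and the
-- first leg v₁ the colour 0 or 1. Recolouring v₁ from 1 to 0, or, when v₁ has colour 0, rotating
-- 0 ↦ 2 ↦ 1 ↦ 0 on every other vertex, injects them into colourings of content μ₁ in which
-- (u, v₁) is coloured (2, 0) resp. (1, 0); colourings with (u, v₁) coloured (2, 1) are missed, and
-- one exists. Hence [m_μ₀] X < [m_μ₁] X. Turning the last 0 of the first row of a tableau into a 1
-- shows K_{λμ₁} ≤ K_{λμ₀}, so Schur positivity would force [m_μ₁] X ≤ [m_μ₀] X.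

module Submission where

open import Defs
open import Algebra.Properties.CommutativeSemigroup using (interchange)
open import Data.Bool using (Bool; true; false; T; _∧_; _∨_; not; if_then_else_)
open import Data.Fin using (Fin; toℕ; fromℕ<; zero; suc)
open import Data.Fin.Patterns using (0F; 1F; 2F)
open import Data.Fin.Properties using (toℕ<n; toℕ-fromℕ<)
open import Data.Bool.Properties using (T-∧; T-∨)
open import Data.Fin.Permutation as Perm using (Permutation′; _⟨$⟩ʳ_; transpose)
open import Data.List using (List; []; _∷_; map; _++_; concatMap; allFin; tabulate; length; upTo; take; applyUpTo)
open import Data.List.Properties using (map-++; map-∘; map-cong; map-cong-local; map-tabulate; ∷-injective)
open import Data.Nat
  using (ℕ; zero; suc; _+_; _*_; _∸_; _≤_; _<_; _≡ᵇ_; _<ᵇ_; _≤ᵇ_; z≤n; s≤s; z<s; s<s; _≟_; _<?_)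
open import Data.Nat.ListAction using (sum)
open import Data.Nat.ListAction.Properties using (sum-++)
open import Data.Nat.Properties
open import Data.Nat.Tactic.RingSolver using (solve-∀)
open import Data.Product using (_×_; _,_; proj₁; proj₂)
open import Data.Sum using (_⊎_; inj₁; inj₂; [_,_])
open import Data.Vec as Vec using (Vec; []; _∷_; lookup; toList)
open import Data.Vec.Properties using (toList-cast)
open import Data.List.Relation.Unary.All using (All; []; _∷_)
open import Data.List.Relation.Unary.Linked using ([-]; _∷_)
open import Data.List.Relation.Unary.All.Properties
  using (tabulate⁺; tabulate⁻; applyUpTo⁺₁; applyUpTo⁺₂; applyUpTo⁻)
open import Function using (_∘_; _⇔_; mk⇔; Equivalence)
open import Relation.Binary.PropositionalEquality
  using (_≡_; _≢_; refl; sym; trans; cong; cong₂; subst; subst₂; module ≡-Reasoning)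
open import Relation.Nullary using (¬_; yes; no; contradiction)
open import Relation.Nullary.Decidable using (dec-true; dec-false)

open import Algebra.Properties.CommutativeMonoid.Sum +-0-commutativeMonoid
  using (sum-permute; sum-cong-≗) renaming (sum to ∑ᶠ)

𝟙 : Bool → ℕ
𝟙 b = if b then 1 else 0

𝟙≤1 : ∀ b → 𝟙 b ≤ 1
𝟙≤1 true  = ≤-refl
𝟙≤1 false = z≤n

𝟙-≡ : ∀ {x y} → x ≡ y → 𝟙 (x ≡ᵇ y) ≡ 1
𝟙-≡ {x} {y} x≡y = cong 𝟙 (dec-true (x ≟ y) x≡y)

𝟙-≢ : ∀ {x y} → x ≢ y → 𝟙 (x ≡ᵇ y) ≡ 0
𝟙-≢ {x} {y} x≢y = cong 𝟙 (dec-false (x ≟ y) x≢y)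

𝟙-mono : ∀ {a b} → (T a → T b) → 𝟙 a ≤ 𝟙 b
𝟙-mono {false}         _   = z≤n
𝟙-mono {true}  {true}  _   = ≤-refl
𝟙-mono {true}  {false} a⇒b = contradiction (a⇒b _) λ ()

𝟙-⊎ : ∀ {a b c} → (T a → T b ⊎ T c) → 𝟙 a ≤ 𝟙 b + 𝟙 c
𝟙-⊎ {false}         _       = z≤n
𝟙-⊎ {true} {b} {c} a⇒b⊎c = [ (λ tb → ≤-trans (𝟙-mono {true} {b} (λ _ → tb)) (m≤m+n _ _))
                             , (λ tc → ≤-trans (𝟙-mono {true} {c} (λ _ → tc)) (m≤n+m _ _)) ] (a⇒b⊎c _)

𝟙-distinct : ∀ {x y} c → x ≢ y → 𝟙 (x ≡ᵇ c) + 𝟙 (y ≡ᵇ c) ≤ 1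
𝟙-distinct {x} {y} c x≢y with x ≟ c
... | yes refl = ≤-reflexive (cong₂ _+_ (𝟙-≡ {x} refl) (𝟙-≢ (x≢y ∘ sym)))
... | no x≢c   = ≤-trans (≤-reflexive (cong (_+ 𝟙 (y ≡ᵇ c)) (𝟙-≢ x≢c))) (𝟙≤1 _)

T-all : ∀ {A : Set} (p : A → Bool) xs → T (all p xs) ⇔ All (T ∘ p) xs
T-all p []       = mk⇔ (λ _ → []) (λ _ → _)
T-all p (x ∷ xs) = mk⇔
  (λ t → let px , pxs = Equivalence.to T-∧ t in px ∷ Equivalence.to (T-all p xs) pxs)
  (λ { (px ∷ pxs) → Equivalence.from T-∧ (px , Equivalence.from (T-all p xs) pxs) })

T-all-allFin : ∀ {d} (p : Fin d → Bool) → T (all p (allFin d)) ⇔ (∀ v → T (p v))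
T-all-allFin p = mk⇔ (tabulate⁻ ∘ Equivalence.to (T-all p _)) (Equivalence.from (T-all p _) ∘ tabulate⁺)

T-not-∨-not : ∀ {a b} → T (not a ∨ not b) ⇔ (T a → ¬ T b)
T-not-∨-not {true}  {true}  = mk⇔ (λ ()) (λ a⇒¬b → a⇒¬b _ _)
T-not-∨-not {true}  {false} = mk⇔ (λ _ _ ()) _
T-not-∨-not {false}         = mk⇔ (λ _ ()) _

T-all-upTo : ∀ (p : ℕ → Bool) n → T (all p (upTo n)) ⇔ (∀ {i} → i < n → T (p i))
T-all-upTo p n = mk⇔ (applyUpTo⁻ (λ i → i) n ∘ Equivalence.to (T-all p _))
                     (Equivalence.from (T-all p _) ∘ applyUpTo⁺₁ (λ i → i) n)

==ᴸ⇒≡ : ∀ xs ys → T (xs ==ᴸ ys) → xs ≡ ys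
==ᴸ⇒≡ []       []       _  = refl
==ᴸ⇒≡ (x ∷ xs) (y ∷ ys) eq = let x≡y , xs≡ys = Equivalence.to T-∧ eq in
  cong₂ _∷_ (≡ᵇ⇒≡ x y x≡y) (==ᴸ⇒≡ xs ys xs≡ys)

==ᴸ-refl : ∀ xs → T (xs ==ᴸ xs)
==ᴸ-refl []       = _
==ᴸ-refl (x ∷ xs) = Equivalence.from T-∧ (≡⇒≡ᵇ x x refl , ==ᴸ-refl xs)

∑< : ℕ → (ℕ → ℕ) → ℕ
∑< zero    f = 0
∑< (suc k) f = f 0 + ∑< k (f ∘ suc)

∑<-cong : ∀ k {f g} → (∀ {p} → p < k → f p ≡ g p) → ∑< k f ≡ ∑< k g
∑<-cong zero    f≡g = refl
∑<-cong (suc k) f≡g = cong₂ _+_ (f≡g z<s) (∑<-cong k (f≡g ∘ s<s))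

∑<-+ : ∀ a b f → ∑< (a + b) f ≡ ∑< a f + ∑< b (λ p → f (a + p))
∑<-+ zero    b f = refl
∑<-+ (suc a) b f = trans (cong (f 0 +_) (∑<-+ a b (f ∘ suc))) (sym (+-assoc (f 0) _ _))

∑<-≤-length : ∀ k {f} → (∀ {p} → p < k → f p ≤ 1) → ∑< k f ≤ k
∑<-≤-length zero    f≤1 = z≤n
∑<-≤-length (suc k) f≤1 = +-mono-≤ (f≤1 z<s) (∑<-≤-length k (f≤1 ∘ s<s))

∑<-≥-length : ∀ k {f} → (∀ {p} → p < k → f p ≡ 1) → k ≤ ∑< k f
∑<-≥-length zero    f≡1 = z≤n
∑<-≥-length (suc k) f≡1 = +-mono-≤ (≤-reflexive (sym (f≡1 z<s))) (∑<-≥-length k (f≡1 ∘ s<s))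

∑<-zero : ∀ k {f} → (∀ {p} → p < k → f p ≡ 0) → ∑< k f ≡ 0
∑<-zero zero    f≡0 = refl
∑<-zero (suc k) f≡0 = cong₂ _+_ (f≡0 z<s) (∑<-zero k (f≡0 ∘ s<s))

∑<-supported : ∀ d N {f} → N ≤ d → (∀ {p} → p < d → f p ≤ 1) →
               (∀ {p} → p < d → N ≤ p → f p ≡ 0) → ∑< d f ≤ N
∑<-supported d N {f} N≤d f≤1 f≡0 = begin
  ∑< d f                                  ≡⟨ cong (λ e → ∑< e f) (m+[n∸m]≡n N≤d) ⟨
  ∑< (N + (d ∸ N)) f                      ≡⟨ ∑<-+ N (d ∸ N) f ⟩
  ∑< N f + ∑< (d ∸ N) (λ p → f (N + p))   ≡⟨ cong (∑< N f +_) (∑<-zero (d ∸ N) tail≡0) ⟩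
  ∑< N f + 0                              ≡⟨ +-identityʳ _ ⟩
  ∑< N f                                  ≤⟨ ∑<-≤-length N (λ p<N → f≤1 (<-≤-trans p<N N≤d)) ⟩
  N                                       ∎
  where
  open ≤-Reasoning
  tail≡0 : ∀ {p} → p < d ∸ N → f (N + p) ≡ 0
  tail≡0 {p} p<d∸N = f≡0 (subst (N + p <_) (m+[n∸m]≡n N≤d) (+-monoʳ-< N p<d∸N)) (m≤m+n N p)

∑<-window : ∀ d a len {f} → a + len ≤ d → (∀ {j} → j < len → f (a + j) ≡ 1) → len ≤ ∑< d f
∑<-window d a len {f} a+len≤d f≡1 = begin
  len                                                   ≤⟨ ∑<-≥-length len f≡1 ⟩
  ∑< len (λ j → f (a + j))                              ≤⟨ m≤n+m _ _ ⟩
  ∑< a f + ∑< len (λ j → f (a + j))                     ≡⟨ ∑<-+ a len f ⟨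
  ∑< (a + len) f                                        ≤⟨ m≤m+n _ _ ⟩
  ∑< (a + len) f + ∑< (d ∸ (a + len)) (λ p → f (a + len + p)) ≡⟨ ∑<-+ (a + len) (d ∸ (a + len)) f ⟨
  ∑< (a + len + (d ∸ (a + len))) f                      ≡⟨ cong (λ e → ∑< e f) (m+[n∸m]≡n a+len≤d) ⟩
  ∑< d f                                                ∎
  where open ≤-Reasoning

∑<-update : ∀ d q {f g} → q < d → (∀ {p} → p < d → p ≢ q → f p ≡ g p) →
            ∑< d f + g q ≡ ∑< d g + f q
∑<-update (suc d) zero {f} {g} _ f≡g = begin
  f 0 + ∑< d (f ∘ suc) + g 0   ≡⟨ cong (λ s → f 0 + s + g 0) (∑<-cong d (λ p<d → f≡g (s<s p<d) λ ())) ⟩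
  f 0 + ∑< d (g ∘ suc) + g 0   ≡⟨ +-comm (f 0 + _) (g 0) ⟩
  g 0 + (f 0 + ∑< d (g ∘ suc)) ≡⟨ cong (g 0 +_) (+-comm (f 0) _) ⟩
  g 0 + (∑< d (g ∘ suc) + f 0) ≡⟨ +-assoc (g 0) _ _ ⟨
  g 0 + ∑< d (g ∘ suc) + f 0   ∎
  where open ≡-Reasoning
∑<-update (suc d) (suc q) {f} {g} (s<s q<d) f≡g = begin
  f 0 + ∑< d (f ∘ suc) + g (suc q)   ≡⟨ +-assoc (f 0) _ _ ⟩
  f 0 + (∑< d (f ∘ suc) + g (suc q)) ≡⟨ cong₂ _+_ (f≡g z<s λ ()) (∑<-update d q q<d λ p<d p≢q →
                                                                      f≡g (s<s p<d) (p≢q ∘ suc-injective)) ⟩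
  g 0 + (∑< d (g ∘ suc) + f (suc q)) ≡⟨ +-assoc (g 0) _ _ ⟨
  g 0 + ∑< d (g ∘ suc) + f (suc q)   ∎
  where open ≡-Reasoning

∑<-pairs : ∀ t {f} → (∀ {p} → suc p < t * 2 → f p + f (suc p) ≤ 1) → ∑< (t * 2) f ≤ t
∑<-pairs zero    _ = z≤n
∑<-pairs (suc t) {f} pair≤1 = begin
  f 0 + (f 1 + ∑< (t * 2) (λ p → f (2 + p))) ≡⟨ +-assoc (f 0) _ _ ⟨
  f 0 + f 1 + ∑< (t * 2) (λ p → f (2 + p))
    ≤⟨ +-mono-≤ (pair≤1 (s<s z<s)) (∑<-pairs t (pair≤1 ∘ s<s ∘ s<s)) ⟩
  suc t                                    ∎
  where open ≤-Reasoning

Σʷ : ∀ ℓ d → (Vec (Fin ℓ) d → ℕ) → ℕ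
Σʷ ℓ d h = sum (map h (allVecs ℓ d))

sum-map-mono : ∀ {A : Set} {f g : A → ℕ} xs → (∀ x → f x ≤ g x) → sum (map f xs) ≤ sum (map g xs)
sum-map-mono []       f≤g = z≤n
sum-map-mono (x ∷ xs) f≤g = +-mono-≤ (f≤g x) (sum-map-mono xs f≤g)

sum-map-+ : ∀ {A : Set} (f g : A → ℕ) xs →
            sum (map (λ x → f x + g x) xs) ≡ sum (map f xs) + sum (map g xs)
sum-map-+ f g []       = refl
sum-map-+ f g (x ∷ xs) = trans (cong (f x + g x +_) (sum-map-+ f g xs))
                               (interchange +-commutativeSemigroup (f x) (g x) _ _)

sum-map-concatMap : ∀ {A B : Set} {ℓ} (h : B → ℕ) (F : A → List B) (g : Fin ℓ → A) →
  sum (map h (concatMap F (tabulate g))) ≡ ∑ᶠ (λ i → sum (map h (F (g i))))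
sum-map-concatMap {ℓ = zero}  h F g = refl
sum-map-concatMap {ℓ = suc ℓ} h F g = begin
  sum (map h (F (g zero) ++ concatMap F (tabulate (g ∘ suc))))
    ≡⟨ cong sum (map-++ h (F (g zero)) _) ⟩
  sum (map h (F (g zero)) ++ map h (concatMap F (tabulate (g ∘ suc))))
    ≡⟨ sum-++ (map h (F (g zero))) _ ⟩
  sum (map h (F (g zero))) + sum (map h (concatMap F (tabulate (g ∘ suc))))
    ≡⟨ cong (sum (map h (F (g zero))) +_) (sum-map-concatMap h F (g ∘ suc)) ⟩
  sum (map h (F (g zero))) + ∑ᶠ (λ i → sum (map h (F (g (suc i)))))
    ∎
  where open ≡-Reasoning

Σʷ-suc : ∀ ℓ d h → Σʷ ℓ (suc d) h ≡ ∑ᶠ (λ i → Σʷ ℓ d (λ w → h (i ∷ w)))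
Σʷ-suc ℓ d h = trans (sum-map-concatMap h (λ i → map (i ∷_) (allVecs ℓ d)) (λ i → i))
                     (sum-cong-≗ (λ i → cong sum (sym (map-∘ {g = h} {f = i ∷_} (allVecs ℓ d)))))

Σʷ-mono : ∀ ℓ d {h g : Vec (Fin ℓ) d → ℕ} → (∀ w → h w ≤ g w) → Σʷ ℓ d h ≤ Σʷ ℓ d g
Σʷ-mono ℓ d = sum-map-mono (allVecs ℓ d)

Σʷ-+ : ∀ ℓ d (h g : Vec (Fin ℓ) d → ℕ) → Σʷ ℓ d (λ w → h w + g w) ≡ Σʷ ℓ d h + Σʷ ℓ d g
Σʷ-+ ℓ d h g = sum-map-+ h g (allVecs ℓ d)

≤-∑ᶠ : ∀ {ℓ} (G : Fin ℓ → ℕ) i → G i ≤ ∑ᶠ G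
≤-∑ᶠ G zero    = m≤m+n _ _
≤-∑ᶠ G (suc i) = ≤-trans (≤-∑ᶠ (G ∘ suc) i) (m≤n+m _ _)

≤-Σʷ : ∀ ℓ d h (w : Vec (Fin ℓ) d) → h w ≤ Σʷ ℓ d h
≤-Σʷ ℓ zero    h []      = m≤m+n _ _
≤-Σʷ ℓ (suc d) h (x ∷ w) = begin
  h (x ∷ w)                            ≤⟨ ≤-Σʷ ℓ d (λ v → h (x ∷ v)) w ⟩
  Σʷ ℓ d (λ v → h (x ∷ v))             ≤⟨ ≤-∑ᶠ (λ i → Σʷ ℓ d (λ v → h (i ∷ v))) x ⟩
  ∑ᶠ (λ i → Σʷ ℓ d (λ v → h (i ∷ v))) ≡⟨ Σʷ-suc ℓ d h ⟨
  Σʷ ℓ (suc d) h                       ∎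
  where open ≤-Reasoning

relabel : ∀ {ℓ d} → (ℕ → Permutation′ ℓ) → Vec (Fin ℓ) d → Vec (Fin ℓ) d
relabel π []      = []
relabel π (x ∷ w) = (π 0 ⟨$⟩ʳ x) ∷ relabel (π ∘ suc) w

Σʷ-relabel : ∀ ℓ d (π : ℕ → Permutation′ ℓ) h → Σʷ ℓ d (h ∘ relabel π) ≡ Σʷ ℓ d h
Σʷ-relabel ℓ zero    π h = refl
Σʷ-relabel ℓ (suc d) π h = begin
  Σʷ ℓ (suc d) (h ∘ relabel π)
    ≡⟨ Σʷ-suc ℓ d (h ∘ relabel π) ⟩
  ∑ᶠ (λ i → Σʷ ℓ d (λ w → h ((π 0 ⟨$⟩ʳ i) ∷ relabel (π ∘ suc) w)))
    ≡⟨ sum-cong-≗ (λ i → Σʷ-relabel ℓ d (π ∘ suc) (λ w → h ((π 0 ⟨$⟩ʳ i) ∷ w))) ⟩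
  ∑ᶠ (λ i → G (π 0 ⟨$⟩ʳ i))
    ≡⟨ sum-permute G (π 0) ⟨
  ∑ᶠ G
    ≡⟨ Σʷ-suc ℓ d h ⟨
  Σʷ ℓ (suc d) h
    ∎
  where
  open ≡-Reasoning
  G : Fin ℓ → ℕ
  G i = Σʷ ℓ d (λ w → h (i ∷ w))

Σʷ-injection : ∀ ℓ d (π : ℕ → Permutation′ ℓ) {P Q : Vec (Fin ℓ) d → Bool} →
               (∀ w → T (P w) → T (Q (relabel π w))) → Σʷ ℓ d (𝟙 ∘ P) ≤ Σʷ ℓ d (𝟙 ∘ Q)
Σʷ-injection ℓ d π {P} {Q} P⇒Q = begin
  Σʷ ℓ d (𝟙 ∘ P)             ≤⟨ Σʷ-mono ℓ d (λ w → 𝟙-mono (P⇒Q w)) ⟩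
  Σʷ ℓ d (𝟙 ∘ Q ∘ relabel π) ≡⟨ Σʷ-relabel ℓ d π (𝟙 ∘ Q) ⟩
  Σʷ ℓ d (𝟙 ∘ Q)             ∎
  where open ≤-Reasoning

-- The reading of words used by semistandard; positions past the end read 0.
entry : ∀ {ℓ d} → Vec (Fin ℓ) d → ℕ → ℕ
entry w p = at (map toℕ (toList w)) p

entry-lookup : ∀ {ℓ d} (w : Vec (Fin ℓ) d) i → entry w (toℕ i) ≡ toℕ (lookup w i)
entry-lookup (x ∷ w) zero    = refl
entry-lookup (x ∷ w) (suc i) = entry-lookup w i

entry-< : ∀ {ℓ d} (w : Vec (Fin ℓ) d) {p} → p < d → entry w p < ℓ
entry-< (x ∷ w) {zero}  _         = toℕ<n x
entry-< (x ∷ w) {suc p} (s<s p<d) = entry-< w p<d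

record Tracks {ℓ} (σ : Permutation′ ℓ) (f : ℕ → ℕ) : Set where
  constructor tracking
  field track : ∀ x → toℕ (σ ⟨$⟩ʳ x) ≡ f (toℕ x)
open Tracks

entry-relabel : ∀ {ℓ d} (π : ℕ → Permutation′ ℓ) (f : ℕ → ℕ) (w : Vec (Fin ℓ) d) {p} → p < d →
                Tracks (π p) f → entry (relabel π w) p ≡ f (entry w p)
entry-relabel π f (x ∷ w) {zero}  _         πp≈f = track πp≈f x
entry-relabel π f (x ∷ w) {suc p} (s<s p<d) πp≈f = entry-relabel (π ∘ suc) f w p<d πp≈f

occ : ∀ {ℓ d} → Vec (Fin ℓ) d → ℕ → ℕ
occ {d = d} w c = ∑< d (λ p → 𝟙 (entry w p ≡ᵇ c))

content : ∀ {ℓ d} → Vec (Fin ℓ) d → List ℕ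
content {ℓ} w = map (occ w) (upTo ℓ)

entry-cast : ∀ {ℓ d d′} .(eq : d′ ≡ d) (w : Vec (Fin ℓ) d′) p → entry (Vec.cast eq w) p ≡ entry w p
entry-cast eq w p = cong (λ xs → at (map toℕ xs) p) (toList-cast eq w)

entry-++ˡ : ∀ {ℓ a b} (u : Vec (Fin ℓ) a) (v : Vec (Fin ℓ) b) {p} → p < a → entry (u Vec.++ v) p ≡ entry u p
entry-++ˡ (x ∷ u) v {zero}  _         = refl
entry-++ˡ (x ∷ u) v {suc p} (s<s p<a) = entry-++ˡ u v p<a

entry-++ʳ : ∀ {ℓ a b} (u : Vec (Fin ℓ) a) (v : Vec (Fin ℓ) b) i → entry (u Vec.++ v) (a + i) ≡ entry v i
entry-++ʳ []      v i = refl
entry-++ʳ (x ∷ u) v i = entry-++ʳ u v i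

occ-cast : ∀ {ℓ d d′} (eq : d′ ≡ d) (w : Vec (Fin ℓ) d′) c → occ (Vec.cast eq w) c ≡ occ w c
occ-cast {d = d} refl w c = ∑<-cong d (λ {p} _ → cong (λ x → 𝟙 (x ≡ᵇ c)) (entry-cast refl w p))

occ-++ : ∀ {ℓ a b} (u : Vec (Fin ℓ) a) (v : Vec (Fin ℓ) b) c → occ (u Vec.++ v) c ≡ occ u c + occ v c
occ-++ []      v c = refl
occ-++ (x ∷ u) v c = trans (cong (𝟙 (toℕ x ≡ᵇ c) +_) (occ-++ u v c)) (sym (+-assoc (𝟙 (toℕ x ≡ᵇ c)) _ _))

occ-replicate : ∀ {ℓ} j (x : Fin ℓ) c → occ (Vec.replicate j x) c ≡ j * 𝟙 (toℕ x ≡ᵇ c)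
occ-replicate zero    x c = refl
occ-replicate (suc j) x c = cong (𝟙 (toℕ x ≡ᵇ c) +_) (occ-replicate j x c)

sum-tabulate-lookup : ∀ {ℓ d} (F : ℕ → ℕ) (w : Vec (Fin ℓ) d) →
                      sum (tabulate (λ i → F (toℕ (lookup w i)))) ≡ ∑< d (λ p → F (entry w p))
sum-tabulate-lookup F []      = refl
sum-tabulate-lookup F (x ∷ w) = cong (F (toℕ x) +_) (sum-tabulate-lookup F w)

countVal≡occ : ∀ {ℓ d} (w : Vec (Fin ℓ) d) c → countVal w c ≡ occ w c
countVal≡occ {d = d} w c =
  trans (cong sum (map-tabulate {n = d} (λ i → i) (λ i → 𝟙 (toℕ (lookup w i) ≡ᵇ c))))
        (sum-tabulate-lookup (λ x → 𝟙 (x ≡ᵇ c)) w)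

hasContent⇒content : ∀ α {d} (w : Vec (Fin (length α)) d) → T (hasContent α w) → content w ≡ α
hasContent⇒content α w has =
  trans (map-cong (sym ∘ countVal≡occ w) _) (==ᴸ⇒≡ _ α has)

content⇒hasContent : ∀ α {d} (w : Vec (Fin (length α)) d) → content w ≡ α → T (hasContent α w)
content⇒hasContent α w content≡α =
  subst₂ (λ xs ys → T (xs ==ᴸ ys)) (map-cong (sym ∘ countVal≡occ w) (upTo (length α))) content≡α
         (==ᴸ-refl (content w))

record AgreeOff {ℓ d} (q : ℕ) (f : ℕ → ℕ) (w w′ : Vec (Fin ℓ) d) : Set where
  constructor agreeOff
  field agree : ∀ {p} → p < d → p ≢ q → entry w′ p ≡ f (entry w p)
open AgreeOff

occ-update : ∀ {ℓ d} {q a b} {f g : ℕ → ℕ} {w w′ : Vec (Fin ℓ) d} → (∀ x → g (f x) ≡ x) → q < d →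
             AgreeOff q f w w′ → entry w q ≡ a → entry w′ q ≡ b →
             ∀ c → occ w′ (f c) + 𝟙 (a ≡ᵇ c) ≡ occ w c + 𝟙 (b ≡ᵇ f c)
occ-update {d = d} {q} {f = f} {g} {w} {w′} g∘f≡id q<d w≈w′ refl refl c =
  ∑<-update d q q<d λ {p} p<d p≢q →
    trans (cong (λ x → 𝟙 (x ≡ᵇ f c)) (agree w≈w′ p<d p≢q)) (𝟙-f (entry w p))
  where
  𝟙-f : ∀ x → 𝟙 (f x ≡ᵇ f c) ≡ 𝟙 (x ≡ᵇ c)
  𝟙-f x with x ≟ c
  ... | yes refl = trans (𝟙-≡ {f x} refl) (sym (𝟙-≡ {x} refl))
  ... | no x≢c   = trans (𝟙-≢ fx≢fc) (sym (𝟙-≢ x≢c))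
    where
    fx≢fc : f x ≢ f c
    fx≢fc fx≡fc = x≢c (trans (sym (g∘f≡id x)) (trans (cong g fx≡fc) (g∘f≡id c)))

content₃ : ∀ {d} (w : Vec (Fin 3) d) {a b c} →
           content w ≡ a ∷ b ∷ c ∷ [] ⇔ (occ w 0 ≡ a × occ w 1 ≡ b × occ w 2 ≡ c)
content₃ w = mk⇔
  (λ eq → let a≡ , eq′ = ∷-injective eq ; b≡ , eq″ = ∷-injective eq′ in
          a≡ , b≡ , proj₁ (∷-injective eq″))
  (λ (a≡ , b≡ , c≡) → cong₂ _∷_ a≡ (cong₂ _∷_ b≡ (cong (_∷ []) c≡)))

+0≡+1⇒≡suc : ∀ {x y} → x + 0 ≡ y + 1 → x ≡ suc y
+0≡+1⇒≡suc {x} {y} eq = trans (sym (+-identityʳ x)) (trans eq (+-comm y 1))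

+1≡+0⇒suc≡ : ∀ {x y} → x + 1 ≡ y + 0 → suc x ≡ y
+1≡+0⇒suc≡ {x} {y} eq = trans (+-comm 1 x) (trans eq (+-identityʳ y))

+0≡+0⇒≡ : ∀ {x y} → x + 0 ≡ y + 0 → x ≡ y
+0≡+0⇒≡ {x} {y} = +-cancelʳ-≡ 0 x y

_[_↦_] : ∀ {A : Set} → (ℕ → A) → ℕ → A → ℕ → A
(f [ q ↦ x ]) p = if p ≡ᵇ q then x else f p

[↦]-≡ : ∀ {A : Set} (f : ℕ → A) q x → (f [ q ↦ x ]) q ≡ x
[↦]-≡ f q x = cong (if_then x else f q) (dec-true (q ≟ q) refl)

[↦]-≢ : ∀ {A : Set} (f : ℕ → A) {q} x {p} → p ≢ q → (f [ q ↦ x ]) p ≡ f p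
[↦]-≢ f {q} x {p} p≢q = cong (if_then x else f p) (dec-false (p ≟ q) p≢q)

module _ {ℓ d} {σ τ : Permutation′ ℓ} {f h : ℕ → ℕ} (σ≈f : Tracks σ f) (τ≈h : Tracks τ h)
         (q : ℕ) (w : Vec (Fin ℓ) d) where

  relabel-agreeOff : AgreeOff q f w (relabel ((λ _ → σ) [ q ↦ τ ]) w)
  relabel-agreeOff = agreeOff λ {p} p<d p≢q →
    entry-relabel _ f w p<d (subst (λ π → Tracks π f) (sym ([↦]-≢ (λ _ → σ) τ p≢q)) σ≈f)

  entry-relabel-at : q < d → entry (relabel ((λ _ → σ) [ q ↦ τ ]) w) q ≡ h (entry w q)
  entry-relabel-at q<d =
    entry-relabel _ h w q<d (subst (λ π → Tracks π h) (sym ([↦]-≡ (λ _ → σ) q τ)) τ≈h)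

swap₀₁ : ∀ {r} → Permutation′ (suc (suc r))
swap₀₁ = transpose zero (suc zero)

swap₀₁ℕ : ℕ → ℕ
swap₀₁ℕ 0 = 1
swap₀₁ℕ 1 = 0
swap₀₁ℕ x = x

swap₀₁-tracks : ∀ {r} → Tracks (swap₀₁ {r}) swap₀₁ℕ
swap₀₁-tracks = tracking λ where
  zero          → refl
  (suc zero)    → refl
  (suc (suc x)) → refl

id-tracks : ∀ {ℓ} → Tracks (Perm.id {ℓ}) (λ x → x)
id-tracks = tracking λ _ → refl

rotate : Permutation′ 3
rotate = transpose 1F 2F Perm.∘ₚ transpose 0F 2F

rotℕ rotℕ⁻¹ : ℕ → ℕ
rotℕ 0 = 2
rotℕ 1 = 0
rotℕ 2 = 1
rotℕ x = x
rotℕ⁻¹ 2 = 0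
rotℕ⁻¹ 0 = 1
rotℕ⁻¹ 1 = 2
rotℕ⁻¹ x = x

rotate-tracks : Tracks rotate rotℕ
rotate-tracks = tracking λ where
  0F → refl
  1F → refl
  2F → refl

rotℕ⁻¹∘rotℕ : ∀ x → rotℕ⁻¹ (rotℕ x) ≡ x
rotℕ⁻¹∘rotℕ 0                   = refl
rotℕ⁻¹∘rotℕ 1                   = refl
rotℕ⁻¹∘rotℕ 2                   = refl
rotℕ⁻¹∘rotℕ (suc (suc (suc x))) = refl

-- Semistandard tableaux

rowStart : List ℕ → ℕ → ℕ
rowStart L i = sum (take i L)

record Semistandard (L : List ℕ) (v : ℕ → ℕ) : Set where
  field
    rows : ∀ {i j} → i < length L → j < at L i ∸ 1 → v (rowStart L i + j) ≤ v (rowStart L i + suc j)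
    cols : ∀ {i j} → i < length L ∸ 1 → j < at L (suc i) → v (rowStart L i + j) < v (rowStart L (suc i) + j)

T-semistandard : ∀ L {ℓ d} (Y : Vec (Fin ℓ) d) → T (semistandard L Y) ⇔ Semistandard L (entry Y)
T-semistandard L Y = mk⇔
  (λ t → let r , c = Equivalence.to T-∧ t in record
    { rows = λ i<ℓ j< → ≤ᵇ⇒≤ _ _ (Equivalence.to (T-all-upTo _ _) (Equivalence.to (T-all-upTo _ _) r i<ℓ) j<)
    ; cols = λ i<ℓ j< → <ᵇ⇒< _ _ (Equivalence.to (T-all-upTo _ _) (Equivalence.to (T-all-upTo _ _) c i<ℓ) j<) })
  (λ ss → let open Semistandard ss in Equivalence.from T-∧
    ( Equivalence.from (T-all-upTo _ _) (λ i<ℓ →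
        Equivalence.from (T-all-upTo _ _) (λ j< → ≤⇒≤ᵇ (rows i<ℓ j<)))
    , Equivalence.from (T-all-upTo _ _) (λ i<ℓ →
        Equivalence.from (T-all-upTo _ _) (λ j< → <⇒<ᵇ (cols i<ℓ j<)))))

raise-semistandard :
  ∀ {L v v′ q} → Semistandard L v → (∀ p → v p ≤ v′ p) → (∀ {p} → p ≢ q → v′ p ≡ v p) →
  (∀ {i j} → i < length L → j < at L i ∸ 1 → rowStart L i + j ≡ q → v′ q ≤ v′ (suc q)) →
  (∀ {i j} → i < length L ∸ 1 → j < at L (suc i) → rowStart L i + j ≡ q →
             v′ q < v′ (rowStart L (suc i) + j)) →
  Semistandard L v′
raise-semistandard {L} {v} {v′} {q} ss v≤v′ same right below = record { rows = rows′ ; cols = cols′ }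
  where
  open Semistandard ss
  rows′ : ∀ {i j} → i < length L → j < at L i ∸ 1 → v′ (rowStart L i + j) ≤ v′ (rowStart L i + suc j)
  rows′ {i} {j} i<ℓ j< with rowStart L i + j ≟ q
  ... | yes refl = subst (λ x → v′ (rowStart L i + j) ≤ v′ x) (sym (+-suc (rowStart L i) j)) (right i<ℓ j< refl)
  ... | no ≢q    = ≤-trans (≤-reflexive (same ≢q)) (≤-trans (rows i<ℓ j<) (v≤v′ _))
  cols′ : ∀ {i j} → i < length L ∸ 1 → j < at L (suc i) →
          v′ (rowStart L i + j) < v′ (rowStart L (suc i) + j)
  cols′ {i} {j} i<ℓ j< with rowStart L i + j ≟ q
  ... | yes refl = below i<ℓ j< refl
  ... | no ≢q    = <-≤-trans (≤-<-trans (≤-reflexive (same ≢q)) (cols i<ℓ j<)) (v≤v′ _)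

record Cell (L : List ℕ) (p : ℕ) : Set where
  constructor cell
  field
    row col  : ℕ
    row<     : row < length L
    col<     : col < at L row
    position : p ≡ rowStart L row + col

cellOf : ∀ L {p} → p < sum L → Cell L p
cellOf (x ∷ L) {p} p<sum with p <? x
... | yes p<x = cell 0 p z<s p<x refl
... | no p≮x  = cell (suc row) col (s<s row<) col< (begin
  p                            ≡⟨ m+[n∸m]≡n (≮⇒≥ p≮x) ⟨
  x + (p ∸ x)                  ≡⟨ cong (x +_) position ⟩
  x + (rowStart L row + col)   ≡⟨ +-assoc x _ col ⟨
  x + rowStart L row + col     ∎)
  where
  open ≡-Reasoning
  p∸x<sum : p ∸ x < sum L
  p∸x<sum = +-cancelˡ-< x (p ∸ x) (sum L) (subst (_< x + sum L) (sym (m+[n∸m]≡n (≮⇒≥ p≮x))) p<sum)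
  open Cell (cellOf L p∸x<sum)

at-0≤rowStart-suc : ∀ L i → at L 0 ≤ rowStart L (suc i)
at-0≤rowStart-suc []      i = z≤n
at-0≤rowStart-suc (x ∷ L) i = m≤m+n x _

at-0≤sum : ∀ L → at L 0 ≤ sum L
at-0≤sum []      = z≤n
at-0≤sum (x ∷ L) = m≤m+n x _

rowStart-1+at-1≤sum : ∀ L → rowStart L 1 + at L 1 ≤ sum L
rowStart-1+at-1≤sum []          = z≤n
rowStart-1+at-1≤sum (x ∷ [])    = ≤-reflexive (+-identityʳ (x + 0))
rowStart-1+at-1≤sum (x ∷ y ∷ L) = ≤-trans (≤-reflexive (cong (_+ y) (+-identityʳ x))) (+-monoʳ-≤ x (m≤m+n y _))

at-pos⇒< : ∀ L i → 0 < at L i → i < length L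
at-pos⇒< (x ∷ L) zero    _   = z<s
at-pos⇒< (x ∷ L) (suc i) pos = s<s (at-pos⇒< L i pos)

suc<⇒<∸1 : ∀ {j x} → suc j < x → j < x ∸ 1
suc<⇒<∸1 {x = suc x} (s<s j<x) = j<x

<∸1⇒suc< : ∀ {j x} → j < x ∸ 1 → suc j < x
<∸1⇒suc< {x = suc x} j<x = s<s j<x

-- A semistandard tableau with more 0s than 1s: its 0s fill the first a+1 cells of the first row,
-- and turning the last of them into a 1 leaves it semistandard.
module LastZero {L : List ℕ} {d : ℕ} (sumL≡d : sum L ≡ d) {v : ℕ → ℕ} (ss : Semistandard L v) {a b : ℕ}
                (zeros : ∑< d (λ p → 𝟙 (v p ≡ᵇ 0)) ≡ suc a) (ones : ∑< d (λ p → 𝟙 (v p ≡ᵇ 1)) ≡ b)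
                (b≤a : b ≤ a)
                where
  open Semistandard ss

  outside-first-row : ∀ {p} → p < d → at L 0 ≤ p → 1 ≤ v p
  outside-first-row p<d L₀≤p with cellOf L (subst (_ <_) (sym sumL≡d) p<d)
  ... | cell zero    col _   col< refl = contradiction L₀≤p (<⇒≱ col<)
  ... | cell (suc i) col i<ℓ col< refl = <-≤-trans z<s (cols (suc<⇒<∸1 i<ℓ) col<)

  row-mono : ∀ {i j j′} → i < length L → j ≤ j′ → j′ < at L i →
             v (rowStart L i + j) ≤ v (rowStart L i + j′)
  row-mono {j′ = zero}   _   z≤n  _ = ≤-refl
  row-mono {j = j} {suc j′} i<ℓ j≤1+j′ 1+j′< with j ≟ suc j′
  ... | yes refl = ≤-refl
  ... | no j≢    = ≤-trans (row-mono i<ℓ (≤-pred (≤∧≢⇒< j≤1+j′ j≢)) (<-trans (n<1+n j′) 1+j′<))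
                           (rows i<ℓ (suc<⇒<∸1 1+j′<))

  first-row-mono : ∀ {j j′} → j ≤ j′ → j′ < at L 0 → v j ≤ v j′
  first-row-mono j≤j′ j′< = row-mono (at-pos⇒< L 0 (≤-<-trans z≤n j′<)) j≤j′ j′<

  a<d : a < d
  a<d = subst (_≤ d) zeros (∑<-≤-length d (λ _ → 𝟙≤1 _))

  va≡0 : v a ≡ 0
  va≡0 with v a ≟ 0
  ... | yes va≡0 = va≡0
  ... | no  va≢0 =
    contradiction (subst (_≤ a) zeros (∑<-supported d a (<⇒≤ a<d) (λ _ → 𝟙≤1 _) no-zero)) 1+n≰n
    where
    no-zero : ∀ {p} → p < d → a ≤ p → 𝟙 (v p ≡ᵇ 0) ≡ 0
    no-zero {p} p<d a≤p with p <? at L 0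
    ... | yes p<L₀ = 𝟙-≢ (>⇒≢ (<-≤-trans (n≢0⇒n>0 va≢0) (first-row-mono a≤p p<L₀)))
    ... | no  p≮L₀ = 𝟙-≢ (>⇒≢ (outside-first-row p<d (≮⇒≥ p≮L₀)))

  a<L₀ : a < at L 0
  a<L₀ with a <? at L 0
  ... | yes a<L₀ = a<L₀
  ... | no  a≮L₀ = contradiction (outside-first-row a<d (≮⇒≥ a≮L₀)) (λ 1≤va → <⇒≢ 1≤va (sym va≡0))

  right-of-a : suc a < at L 0 → 1 ≤ v (suc a)
  right-of-a 1+a< with v (suc a) ≟ 0
  ... | no  v≢0 = n≢0⇒n>0 v≢0
  ... | yes v≡0 = contradiction (subst (suc (suc a) ≤_) zeros window) 1+n≰n
    where
    window : suc (suc a) ≤ ∑< d (λ p → 𝟙 (v p ≡ᵇ 0))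
    window = ∑<-window d 0 (suc (suc a)) (≤-trans 1+a< (subst (at L 0 ≤_) sumL≡d (at-0≤sum L)))
               (λ {j} j< → 𝟙-≡ (n≤0⇒n≡0 (subst (v j ≤_) v≡0 (first-row-mono (≤-pred j<) 1+a<))))

  below-a : a < at L 1 → 2 ≤ v (rowStart L 1 + a)
  below-a a<L₁ = case (v (rowStart L 1 + a)) refl
    where
    second-row : ∀ {j} → j ≤ a → rowStart L 1 + j < d
    second-row j≤a = <-≤-trans (+-monoʳ-< (rowStart L 1) (≤-<-trans j≤a a<L₁))
                               (≤-trans (rowStart-1+at-1≤sum L) (≤-reflexive sumL≡d))
    in-second-row : ∀ {j} → j ≤ a → 1 ≤ v (rowStart L 1 + j)
    in-second-row j≤a = outside-first-row (second-row j≤a) (≤-trans (at-0≤rowStart-suc L 0) (m≤m+n _ _))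
    case : ∀ x → v (rowStart L 1 + a) ≡ x → 2 ≤ x
    case 0 v≡0 = contradiction (subst (1 ≤_) v≡0 (in-second-row ≤-refl)) λ ()
    case 1 v≡1 = contradiction (≤-trans (subst (suc a ≤_) ones window) b≤a) 1+n≰n
      where
      ℓ>1 : 1 < length L
      ℓ>1 = at-pos⇒< L 1 (≤-<-trans z≤n a<L₁)
      window : suc a ≤ ∑< d (λ p → 𝟙 (v p ≡ᵇ 1))
      window = ∑<-window d (rowStart L 1) (suc a)
                 (subst (_≤ d) (sym (+-suc (rowStart L 1) a)) (second-row ≤-refl))
        (λ {j} j< → 𝟙-≡ (≤-antisym (subst (v (rowStart L 1 + j) ≤_) v≡1 (row-mono ℓ>1 (≤-pred j<) a<L₁))
                                   (in-second-row (≤-pred j<))))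
    case (suc (suc x)) _ = s≤s (s≤s z≤n)

  raise-last-zero : ∀ {v′} → (∀ {p} → p ≢ a → v′ p ≡ v p) → v′ a ≡ 1 → Semistandard L v′
  raise-last-zero {v′} same v′a≡1 = raise-semistandard ss v≤v′ same right below
    where
    v≤v′ : ∀ p → v p ≤ v′ p
    v≤v′ p with p ≟ a
    ... | yes refl = subst (_≤ v′ a) (sym va≡0) z≤n
    ... | no  p≢a  = ≤-reflexive (sym (same p≢a))
    beyond-first-row : ∀ i j → rowStart L (suc i) + j ≢ a
    beyond-first-row i j eq =
      <⇒≱ a<L₀ (≤-trans (at-0≤rowStart-suc L i) (subst (rowStart L (suc i) ≤_) eq (m≤m+n _ j)))
    right : ∀ {i j} → i < length L → j < at L i ∸ 1 → rowStart L i + j ≡ a → v′ a ≤ v′ (suc a)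
    right {zero}  _ j< refl = subst₂ _≤_ (sym v′a≡1) (sym (same (>⇒≢ (n<1+n a)))) (right-of-a (<∸1⇒suc< j<))
    right {suc i} {j} _ _ eq = contradiction eq (beyond-first-row i j)
    below : ∀ {i j} → i < length L ∸ 1 → j < at L (suc i) → rowStart L i + j ≡ a →
            v′ a < v′ (rowStart L (suc i) + j)
    below {zero}  _ j< refl = subst₂ _<_ (sym v′a≡1) (sym (same (beyond-first-row 0 a))) (below-a j<)
    below {suc i} {j} _ _ eq = contradiction eq (beyond-first-row i j)

entry-≥ : ∀ {ℓ d} (w : Vec (Fin ℓ) d) {p} → d ≤ p → entry w p ≡ 0
entry-≥ []      _         = refl
entry-≥ (x ∷ w) (s≤s d≤p) = entry-≥ w d≤p

kostka-raise : ∀ {d} (λ′ μ μ′ : Partition d) {a b rest} →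
               parts μ ≡ suc a ∷ b ∷ rest → parts μ′ ≡ a ∷ suc b ∷ rest → kostka λ′ μ ≤ kostka λ′ μ′
kostka-raise {d} λ′ (mkPartition _ _ _ _) (mkPartition _ (1+b≤a ∷ _) _ _) {a} {b} {rest} refl refl =
  Σʷ-injection (2 + length rest) d π raise
  where
  L = parts λ′
  π : ℕ → Permutation′ (2 + length rest)
  π = (λ _ → Perm.id) [ a ↦ swap₀₁ ]
  raise : ∀ (Y : Vec (Fin (2 + length rest)) d) → T (semistandard L Y ∧ hasContent (suc a ∷ b ∷ rest) Y) →
          T (semistandard L (relabel π Y) ∧ hasContent (a ∷ suc b ∷ rest) (relabel π Y))
  raise Y t = Equivalence.from T-∧
    (Equivalence.from (T-semistandard L Y′) ss′ , content⇒hasContent _ Y′ content′)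
    where
    ss-has = Equivalence.to (T-∧ {semistandard L Y}) t
    ss : Semistandard L (entry Y)
    ss = Equivalence.to (T-semistandard L Y) (proj₁ ss-has)
    content≡ : content Y ≡ suc a ∷ b ∷ rest
    content≡ = hasContent⇒content _ Y (proj₂ ss-has)
    zeros : occ Y 0 ≡ suc a
    zeros  = proj₁ (∷-injective content≡)
    ones : occ Y 1 ≡ b
    ones   = proj₁ (∷-injective (proj₂ (∷-injective content≡)))
    others : map (occ Y) (applyUpTo (λ c → 2 + c) (length rest)) ≡ rest
    others = proj₂ (∷-injective (proj₂ (∷-injective content≡)))
    open LastZero {d = d} (total λ′) ss zeros ones (≤-trans (n≤1+n b) 1+b≤a)
    Y′ = relabel π Y
    Y≈Y′ : AgreeOff a (λ x → x) Y Y′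
    Y≈Y′ = relabel-agreeOff id-tracks swap₀₁-tracks a Y
    Y′a≡1 : entry Y′ a ≡ 1
    Y′a≡1 = trans (entry-relabel-at id-tracks swap₀₁-tracks a Y a<d) (cong swap₀₁ℕ va≡0)
    same : ∀ {p} → p ≢ a → entry Y′ p ≡ entry Y p
    same {p} p≢a with p <? d
    ... | yes p<d = agree Y≈Y′ p<d p≢a
    ... | no  p≮d = trans (entry-≥ Y′ (≮⇒≥ p≮d)) (sym (entry-≥ Y (≮⇒≥ p≮d)))
    ss′ = raise-last-zero same Y′a≡1
    Δ = occ-update (λ _ → refl) a<d Y≈Y′ va≡0 Y′a≡1
    content′ : content Y′ ≡ a ∷ suc b ∷ rest
    content′ = cong₂ _∷_ (suc-injective (+1≡+0⇒suc≡ (trans (Δ 0) (cong (_+ 0) zeros))))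
                (cong₂ _∷_ (+0≡+1⇒≡suc (trans (Δ 1) (cong (_+ 1) ones)))
                           (trans (map-cong-local (applyUpTo⁺₂ _ (length rest) (+0≡+0⇒≡ ∘ Δ ∘ (2 +_))))
                                  others))

schurPositive-mono : ∀ {d} (G : Graph d) → SchurPositive G →
                     ∀ μ ν → (∀ λ′ → kostka λ′ μ ≤ kostka λ′ ν) → coeffM G μ ≤ coeffM G ν
schurPositive-mono G (terms , X≡) μ ν K≤K =
  ≤-trans (≤-reflexive (X≡ μ))
          (≤-trans (sum-map-mono terms (λ (λ′ , c) → *-monoʳ-≤ c (K≤K λ′))) (≤-reflexive (sym (X≡ ν))))

-- Proper colourings of the squid graph

T-proper : ∀ {d ℓ} (G : Graph d) (κ : Vec (Fin ℓ) d) →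
           T (proper G κ) ⇔ (∀ v w → T (G v w) → toℕ (lookup κ v) ≢ toℕ (lookup κ w))
T-proper G κ = mk⇔
  (λ t v w vw κv≡κw → Equivalence.to T-not-∨-not (row⇒ t v w) vw (≡⇒≡ᵇ _ _ κv≡κw))
  (λ ok → Equivalence.from (T-all-allFin _) λ v → Equivalence.from (T-all-allFin _) λ w →
     Equivalence.from T-not-∨-not λ vw → ok v w vw ∘ ≡ᵇ⇒≡ _ _)
  where
  row⇒ : T (proper G κ) → ∀ v w → T (not (G v w) ∨ not (toℕ (lookup κ v) ≡ᵇ toℕ (lookup κ w)))
  row⇒ t v w = Equivalence.to (T-all-allFin _) (Equivalence.to (T-all-allFin _) t v) w

cycleLength : ℕ → ℕ
cycleLength n = 2 * n ∸ 1

data Arc (m : ℕ) : ℕ → ℕ → Set where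
  step  : ∀ {x} → suc x < m → Arc m x (suc x)
  close : Arc m 0 (m ∸ 1)
  leg   : ∀ {y} → m ≤ y → Arc m 0 y

-- squid n a b unfolds to cycleArc? m a b ∨ cycleArc? m b a ∨ legArc? m a b ∨ legArc? m b a.
cycleArc? : ℕ → ℕ → ℕ → Bool
cycleArc? m x y = ((suc x ≡ᵇ y) ∧ (y <ᵇ m)) ∨ ((x ≡ᵇ 0) ∧ (y ≡ᵇ m ∸ 1))

legArc? : ℕ → ℕ → ℕ → Bool
legArc? m x y = (x ≡ᵇ 0) ∧ (m ≤ᵇ y)

cycleArc?⇒Arc : ∀ m x y → T (cycleArc? m x y) → Arc m x y
cycleArc?⇒Arc m x y t with Equivalence.to T-∨ t
... | inj₁ s = let sx≡y , y<m = Equivalence.to T-∧ s in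
  subst (Arc m x) (≡ᵇ⇒≡ _ _ sx≡y) (step (subst (_< m) (sym (≡ᵇ⇒≡ _ _ sx≡y)) (<ᵇ⇒< _ _ y<m)))
... | inj₂ c = let x≡0 , y≡m∸1 = Equivalence.to T-∧ c in
  subst₂ (Arc m) (sym (≡ᵇ⇒≡ x 0 x≡0)) (sym (≡ᵇ⇒≡ y _ y≡m∸1)) close

legArc?⇒Arc : ∀ m x y → T (legArc? m x y) → Arc m x y
legArc?⇒Arc m x y t = let x≡0 , m≤y = Equivalence.to T-∧ t in
  subst (λ z → Arc m z y) (sym (≡ᵇ⇒≡ x 0 x≡0)) (leg (≤ᵇ⇒≤ m y m≤y))

squid⇒Arc : ∀ n (a b : Fin (squidSize n)) → T (squid n a b) →
            Arc (cycleLength n) (toℕ a) (toℕ b) ⊎ Arc (cycleLength n) (toℕ b) (toℕ a)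
squid⇒Arc n a b t with Equivalence.to T-∨ t
... | inj₁ ab = inj₁ (cycleArc?⇒Arc _ _ _ ab)
... | inj₂ t₁ with Equivalence.to T-∨ t₁
...   | inj₁ ba = inj₂ (cycleArc?⇒Arc _ _ _ ba)
...   | inj₂ t₂ with Equivalence.to T-∨ t₂
...     | inj₁ ab = inj₁ (legArc?⇒Arc _ _ _ ab)
...     | inj₂ ba = inj₂ (legArc?⇒Arc _ _ _ ba)

Arc⇒squid : ∀ n (a b : Fin (squidSize n)) → Arc (cycleLength n) (toℕ a) (toℕ b) → T (squid n a b)
Arc⇒squid n a b arc = Equivalence.from T-∨ (arc⇒ arc)
  where
  m = cycleLength n
  arc⇒ : ∀ {x y} → Arc m x y → T (cycleArc? m x y) ⊎ T (cycleArc? m y x ∨ legArc? m x y ∨ legArc? m y x)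
  arc⇒ {x} (step sx<m) =
    inj₁ (Equivalence.from T-∨ (inj₁ (Equivalence.from T-∧ (≡⇒≡ᵇ (suc x) _ refl , <⇒<ᵇ sx<m))))
  arc⇒ close =
    inj₁ (Equivalence.from T-∨ (inj₂ (Equivalence.from (T-∧ {true}) (_ , ≡⇒≡ᵇ (m ∸ 1) _ refl))))
  arc⇒ {y = y} (leg m≤y) =
    inj₂ (Equivalence.from (T-∨ {cycleArc? m y 0}) (inj₂ (Equivalence.from (T-∨ {legArc? m 0 y})
      (inj₁ (Equivalence.from (T-∧ {true}) (_ , ≤⇒≤ᵇ m≤y))))))

ProperSquid : ∀ {ℓ} n → Vec (Fin ℓ) (squidSize n) → Set
ProperSquid n κ =
  ∀ {x y} → x < squidSize n → y < squidSize n → Arc (cycleLength n) x y → entry κ x ≢ entry κ y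

T-proper-squid : ∀ {ℓ} n (κ : Vec (Fin ℓ) (squidSize n)) → T (proper (squid n) κ) ⇔ ProperSquid n κ
T-proper-squid n κ = mk⇔ to from
  where
  entry-fromℕ< : ∀ {x} (x<d : x < squidSize n) → entry κ x ≡ toℕ (lookup κ (fromℕ< x<d))
  entry-fromℕ< x<d = trans (cong (entry κ) (sym (toℕ-fromℕ< x<d))) (entry-lookup κ _)

  to : T (proper (squid n) κ) → ProperSquid n κ
  to t x<d y<d arc κx≡κy = Equivalence.to (T-proper (squid n) κ) t _ _
    (Arc⇒squid n _ _ (subst₂ (Arc _) (sym (toℕ-fromℕ< x<d)) (sym (toℕ-fromℕ< y<d)) arc))
    (trans (sym (entry-fromℕ< x<d)) (trans κx≡κy (entry-fromℕ< y<d)))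

  from : ProperSquid n κ → T (proper (squid n) κ)
  from ok = Equivalence.from (T-proper (squid n) κ) λ a b ab κa≡κb →
    let κa≡κb′ = trans (entry-lookup κ a) (trans κa≡κb (sym (entry-lookup κ b))) in
    [ (λ arc → ok (toℕ<n a) (toℕ<n b) arc κa≡κb′)
    , (λ arc → ok (toℕ<n b) (toℕ<n a) arc (sym κa≡κb′)) ] (squid⇒Arc n a b ab)

alternating : ∀ j → Vec (Fin 3) (j * 2)
alternating zero    = []
alternating (suc j) = 2F ∷ 0F ∷ alternating j

occ-alternating : ∀ j c → occ (alternating j) c ≡ j * (𝟙 (2 ≡ᵇ c) + 𝟙 (0 ≡ᵇ c))
occ-alternating zero    c = refl
occ-alternating (suc j) c =
  trans (cong (λ s → 𝟙 (2 ≡ᵇ c) + (𝟙 (0 ≡ᵇ c) + s)) (occ-alternating j c))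
        (sym (+-assoc (𝟙 (2 ≡ᵇ c)) _ _))

alternating-distinct : ∀ j {p} → suc p < j * 2 → entry (alternating j) p ≢ entry (alternating j) (suc p)
alternating-distinct (suc j)       {0}           _                = λ ()
alternating-distinct (suc zero)    {1}           (s<s (s<s ()))
alternating-distinct (suc (suc j)) {1}           _                = λ ()
alternating-distinct (suc j)       {suc (suc p)} (s<s (s<s sp<2j)) = alternating-distinct j sp<2j

alternating-last : ∀ j → entry (alternating (suc j)) (1 + j * 2) ≡ 0
alternating-last zero    = refl
alternating-last (suc j) = alternating-last j

ones-then-00 : ∀ j → Vec (Fin 3) (j + 2)
ones-then-00 j = Vec.replicate j 1F Vec.++ (0F ∷ 0F ∷ [])

ones-then-00≢2 : ∀ j i → entry (ones-then-00 j) i ≢ 2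
ones-then-00≢2 zero    0             = λ ()
ones-then-00≢2 zero    1             = λ ()
ones-then-00≢2 zero    (suc (suc i)) = λ ()
ones-then-00≢2 (suc j) 0             = λ ()
ones-then-00≢2 (suc j) (suc i)       = ones-then-00≢2 j i

module Squid (k : ℕ) where

  n m d t : ℕ
  n = 3 + k
  m = cycleLength n
  d = squidSize n
  t = suc k

  -- The solver lemmas are stated with m, m ∸ 1 and d in normal form.
  m≡ : m ≡ 2 + (t * 2 + 1)
  m≡ = lemma k
    where
    lemma : ∀ k → suc (suc (k + suc (suc (suc (k + 0))))) ≡ 2 + (suc k * 2 + 1)
    lemma = solve-∀

  m∸1≡ : m ∸ 1 ≡ 2 + (t * 2 + 0)
  m∸1≡ = lemma k
    where
    lemma : ∀ k → suc (k + suc (suc (suc (k + 0)))) ≡ 2 + (suc k * 2 + 0)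
    lemma = solve-∀

  m<d : m < d
  m<d = m<m+n m z<s

  1<m : 1 < m
  1<m = subst (1 <_) (sym m≡) (s<s z<s)

  0<d : 0 < d
  0<d = <-trans z<s m<d

  <m⇒<d : ∀ {p} → p < m → p < d
  <m⇒<d p<m = <-trans p<m m<d

  m∸1<m : m ∸ 1 < m
  m∸1<m = ∸-monoʳ-< z<s (<-trans z<s 1<m)

  m≢0 : m ≢ 0
  m≢0 = >⇒≢ (<-trans z<s 1<m)

  -- The colour of u avoids u₁, u_{2n-2} and the legs, and meets each pair {u_{2i}, u_{2i+1}} at most once.
  colour-of-u-bound : ∀ {ℓ} (κ : Vec (Fin ℓ) d) → ProperSquid n κ → occ κ (entry κ 0) ≤ 2 + k
  colour-of-u-bound κ proper = begin
    ∑< (m + n) f                                          ≡⟨ ∑<-+ m n f ⟩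
    ∑< m f + ∑< n (λ j → f (m + j))                       ≡⟨ cong (∑< m f +_) (∑<-zero n legs≡0) ⟩
    ∑< m f + 0                                            ≡⟨ +-identityʳ _ ⟩
    ∑< m f                                                ≡⟨ cong (λ e → ∑< e f) m≡ ⟩
    f 0 + (f 1 + ∑< (t * 2 + 1) (λ p → f (2 + p)))
      ≡⟨ cong (λ s → f 0 + (f 1 + s)) (∑<-+ (t * 2) 1 (λ p → f (2 + p))) ⟩
    f 0 + (f 1 + (∑< (t * 2) (λ p → f (2 + p)) + (f (2 + (t * 2 + 0)) + 0)))
      ≤⟨ +-mono-≤ (𝟙≤1 (entry κ 0 ≡ᵇ entry κ 0))
                  (+-mono-≤ (≤-reflexive f1≡0)
                            (+-mono-≤ (∑<-pairs t {λ p → f (2 + p)} pairs≤1) (≤-reflexive last≡0))) ⟩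
    1 + (0 + (t + 0))                                     ≡⟨ cong suc (+-identityʳ t) ⟩
    2 + k                                                 ∎
    where
    open ≤-Reasoning
    f : ℕ → ℕ
    f p = 𝟙 (entry κ p ≡ᵇ entry κ 0)
    not-u : ∀ {y} → y < d → Arc m 0 y → f y ≡ 0
    not-u y<d arc = 𝟙-≢ (proper 0<d y<d arc ∘ sym)
    legs≡0 : ∀ {j} → j < n → f (m + j) ≡ 0
    legs≡0 {j} j<n = not-u (+-monoʳ-< m j<n) (leg (m≤m+n m j))
    f1≡0 : f 1 ≡ 0
    f1≡0 = not-u (<m⇒<d 1<m) (step 1<m)
    last≡0 : f (2 + (t * 2 + 0)) + 0 ≡ 0
    last≡0 = trans (+-identityʳ _) (subst (λ y → f y ≡ 0) m∸1≡ (not-u (<m⇒<d m∸1<m) close))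
    pairs≤1 : ∀ {p} → suc p < t * 2 → f (2 + p) + f (3 + p) ≤ 1
    pairs≤1 {p} sp<2t =
      𝟙-distinct (entry κ 0) (proper (<m⇒<d (<-trans (n<1+n _) 3+p<m)) (<m⇒<d 3+p<m) (step 3+p<m))
      where
      3+p<m : 3 + p < m
      3+p<m = subst (3 + p <_) (sym m≡) (s<s (s<s (<-trans sp<2t (m<m+n _ z<s))))

  u-has-colour-2 : (κ : Vec (Fin 3) d) → ProperSquid n κ → occ κ 0 ≡ n → occ κ 1 ≡ n → entry κ 0 ≡ 2
  u-has-colour-2 κ proper occ₀ occ₁ = colour (entry κ 0) refl (entry-< κ 0<d)
    where
    bound : ∀ {c} → entry κ 0 ≡ c → occ κ c ≤ 2 + k
    bound κ0≡c = subst (λ c → occ κ c ≤ 2 + k) κ0≡c (colour-of-u-bound κ proper)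
    colour : ∀ c → entry κ 0 ≡ c → c < 3 → c ≡ 2
    colour 0 κ0≡0 _ = contradiction (subst (_≤ 2 + k) occ₀ (bound κ0≡0)) 1+n≰n
    colour 1 κ0≡1 _ = contradiction (subst (_≤ 2 + k) occ₁ (bound κ0≡1)) 1+n≰n
    colour 2 _    _ = refl
    colour (suc (suc (suc c))) _ (s<s (s<s (s<s ())))

  recolour-leg : ∀ {ℓ} {f g : ℕ → ℕ} {κ κ′ : Vec (Fin ℓ) d} → (∀ x → g (f x) ≡ x) →
                 ProperSquid n κ → AgreeOff m f κ κ′ → entry κ′ m ≢ entry κ′ 0 → ProperSquid n κ′
  recolour-leg {f = f} {g} {κ} {κ′} g∘f≡id proper κ≈κ′ κ′m≢κ′0 {x} {y} x<d y<d arc = case arc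
    where
    off-leg : x ≢ m → y ≢ m → entry κ′ x ≢ entry κ′ y
    off-leg x≢m y≢m κ′x≡κ′y = proper x<d y<d arc (begin
      entry κ x         ≡⟨ g∘f≡id _ ⟨
      g (f (entry κ x)) ≡⟨ cong g (agree κ≈κ′ x<d x≢m) ⟨
      g (entry κ′ x)    ≡⟨ cong g κ′x≡κ′y ⟩
      g (entry κ′ y)    ≡⟨ cong g (agree κ≈κ′ y<d y≢m) ⟩
      g (f (entry κ y)) ≡⟨ g∘f≡id _ ⟩
      entry κ y         ∎)
      where open ≡-Reasoning
    case : Arc m x y → entry κ′ x ≢ entry κ′ y
    case (step sx<m) = off-leg (<⇒≢ (<-trans (n<1+n _) sx<m)) (<⇒≢ sx<m)
    case close       = off-leg (m≢0 ∘ sym) (<⇒≢ m∸1<m)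
    case (leg m≤y) with y ≟ m
    ... | yes refl  = κ′m≢κ′0 ∘ sym
    ... | no y≢m    = off-leg (m≢0 ∘ sym) y≢m

  μ₀ μ₁ : List ℕ
  μ₀ = n ∷ n ∷ 2 + k ∷ []
  μ₁ = suc n ∷ 2 + k ∷ 2 + k ∷ []

  μ₀-partition μ₁-partition : Partition d
  μ₀-partition = mkPartition μ₀ (≤-refl ∷ n≤1+n _ ∷ [-]) (z<s ∷ z<s ∷ z<s ∷ []) (lemma k)
    where
    lemma : ∀ k → 3 + k + (3 + k + (2 + k + 0)) ≡ suc (suc (k + suc (suc (suc (k + 0))))) + suc (suc (suc k))
    lemma = solve-∀
  μ₁-partition =
    mkPartition μ₁ (≤-trans (n≤1+n _) (n≤1+n _) ∷ ≤-refl ∷ [-]) (z<s ∷ z<s ∷ z<s ∷ []) (lemma k)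
    where
    lemma : ∀ k → 4 + k + (2 + k + (2 + k + 0)) ≡ suc (suc (k + suc (suc (suc (k + 0))))) + suc (suc (suc k))
    lemma = solve-∀

  μ₀⊴μ₁ : μ₀-partition ⊴ μ₁-partition
  μ₀⊴μ₁ 0                         = z≤n
  μ₀⊴μ₁ 1                         = +-monoˡ-≤ 0 (n≤1+n n)
  μ₀⊴μ₁ 2                         = ≤-reflexive (lemma k)
    where
    lemma : ∀ k → 3 + k + (3 + k + 0) ≡ 4 + k + (2 + k + 0)
    lemma = solve-∀
  μ₀⊴μ₁ 3                         = ≤-reflexive (trans (total μ₀-partition) (sym (total μ₁-partition)))
  μ₀⊴μ₁ (suc (suc (suc (suc j)))) = ≤-reflexive (trans (total μ₀-partition) (sym (total μ₁-partition)))

  isColouring? : (α : List ℕ) → Vec (Fin (length α)) d → Bool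
  isColouring? α κ = proper (squid n) κ ∧ hasContent α κ

  record IsColouring (α : List ℕ) (κ : Vec (Fin (length α)) d) : Set where
    field
      isProper : ProperSquid n κ
      content≡ : content κ ≡ α

  T-isColouring? : ∀ α κ → T (isColouring? α κ) ⇔ IsColouring α κ
  T-isColouring? α κ = mk⇔
    (λ t → let p , c = Equivalence.to T-∧ t in
           record { isProper = Equivalence.to (T-proper-squid n κ) p ; content≡ = hasContent⇒content α κ c })
    (λ c → let open IsColouring c in
           Equivalence.from T-∧ (Equivalence.from (T-proper-squid n κ) isProper , content⇒hasContent α κ content≡))

  record Colouring (α : List ℕ) (a b : ℕ) (κ : Vec (Fin (length α)) d) : Set where
    field
      isColouring : IsColouring α κ
      u-colour≡   : entry κ 0 ≡ a
      leg-colour≡ : entry κ m ≡ b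
    open IsColouring isColouring public

  colouring? : (α : List ℕ) → ℕ → ℕ → Vec (Fin (length α)) d → Bool
  colouring? α a b κ = isColouring? α κ ∧ (entry κ 0 ≡ᵇ a) ∧ (entry κ m ≡ᵇ b)

  T-colouring? : ∀ α a b κ → T (colouring? α a b κ) ⇔ Colouring α a b κ
  T-colouring? α a b κ = mk⇔
    (λ t → let χ , t′ = Equivalence.to T-∧ t ; u≡ , leg≡ = Equivalence.to T-∧ t′ in
           record { isColouring = Equivalence.to (T-isColouring? α κ) χ
                  ; u-colour≡ = ≡ᵇ⇒≡ _ _ u≡ ; leg-colour≡ = ≡ᵇ⇒≡ _ _ leg≡ })
    (λ c → let open Colouring c in
           Equivalence.from T-∧ (Equivalence.from (T-isColouring? α κ) isColouring ,
                                 Equivalence.from T-∧ (≡⇒≡ᵇ _ _ u-colour≡ , ≡⇒≡ᵇ _ _ leg-colour≡)))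

  swapLeg : ℕ → Permutation′ 3
  swapLeg = (λ _ → Perm.id) [ m ↦ swap₀₁ ]

  swapLeg-colouring : ∀ κ → Colouring μ₀ 2 1 κ → Colouring μ₁ 2 0 (relabel swapLeg κ)
  swapLeg-colouring κ c = record
    { isColouring = record
      { isProper = recolour-leg (λ _ → refl) isProper κ≈κ′
                                (λ eq → 0≢2 (trans (sym κ′m≡0) (trans eq κ′0≡2)))
      ; content≡ = Equivalence.from (content₃ κ′) (occ₀′ , occ₁′ , occ₂′) }
    ; u-colour≡   = κ′0≡2
    ; leg-colour≡ = κ′m≡0 }
    where
    open Colouring c
    κ′ = relabel swapLeg κ
    κ≈κ′ : AgreeOff m (λ x → x) κ κ′
    κ≈κ′ = relabel-agreeOff id-tracks swap₀₁-tracks m κ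
    κ′m≡0 : entry κ′ m ≡ 0
    κ′m≡0 = trans (entry-relabel-at id-tracks swap₀₁-tracks m κ m<d) (cong swap₀₁ℕ leg-colour≡)
    κ′0≡2 : entry κ′ 0 ≡ 2
    κ′0≡2 = trans (agree κ≈κ′ 0<d (m≢0 ∘ sym)) u-colour≡
    0≢2 : 0 ≢ 2
    0≢2 ()
    Δ = occ-update (λ _ → refl) m<d κ≈κ′ leg-colour≡ κ′m≡0
    occ₀ = proj₁ (Equivalence.to (content₃ κ) content≡)
    occ₁ = proj₁ (proj₂ (Equivalence.to (content₃ κ) content≡))
    occ₂ = proj₂ (proj₂ (Equivalence.to (content₃ κ) content≡))
    occ₀′ : occ κ′ 0 ≡ suc n
    occ₀′ = +0≡+1⇒≡suc (trans (Δ 0) (cong (_+ 1) occ₀))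
    occ₁′ : occ κ′ 1 ≡ 2 + k
    occ₁′ = suc-injective (+1≡+0⇒suc≡ (trans (Δ 1) (cong (_+ 0) occ₁)))
    occ₂′ : occ κ′ 2 ≡ 2 + k
    occ₂′ = +0≡+0⇒≡ (trans (Δ 2) (cong (_+ 0) occ₂))

  rotateOffLeg : ℕ → Permutation′ 3
  rotateOffLeg = (λ _ → rotate) [ m ↦ Perm.id ]

  rotateOffLeg-colouring : ∀ κ → Colouring μ₀ 2 0 κ → Colouring μ₁ 1 0 (relabel rotateOffLeg κ)
  rotateOffLeg-colouring κ c = record
    { isColouring = record
      { isProper = recolour-leg {g = rotℕ⁻¹} rotℕ⁻¹∘rotℕ isProper κ≈κ′
                                (λ eq → 0≢1 (trans (sym κ′m≡0) (trans eq κ′0≡1)))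
      ; content≡ = Equivalence.from (content₃ κ′) (occ₀′ , occ₁′ , occ₂′) }
    ; u-colour≡   = κ′0≡1
    ; leg-colour≡ = κ′m≡0 }
    where
    open Colouring c
    κ′ = relabel rotateOffLeg κ
    κ≈κ′ : AgreeOff m rotℕ κ κ′
    κ≈κ′ = relabel-agreeOff rotate-tracks id-tracks m κ
    κ′m≡0 : entry κ′ m ≡ 0
    κ′m≡0 = trans (entry-relabel-at rotate-tracks id-tracks m κ m<d) leg-colour≡
    κ′0≡1 : entry κ′ 0 ≡ 1
    κ′0≡1 = trans (agree κ≈κ′ 0<d (m≢0 ∘ sym)) (cong rotℕ u-colour≡)
    0≢1 : 0 ≢ 1
    0≢1 ()
    Δ = occ-update {g = rotℕ⁻¹} rotℕ⁻¹∘rotℕ m<d κ≈κ′ leg-colour≡ κ′m≡0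
    occ₀ = proj₁ (Equivalence.to (content₃ κ) content≡)
    occ₁ = proj₁ (proj₂ (Equivalence.to (content₃ κ) content≡))
    occ₂ = proj₂ (proj₂ (Equivalence.to (content₃ κ) content≡))
    occ₀′ : occ κ′ 0 ≡ suc n
    occ₀′ = +0≡+1⇒≡suc (trans (Δ 1) (cong (_+ 1) occ₁))
    occ₁′ : occ κ′ 1 ≡ 2 + k
    occ₁′ = +0≡+0⇒≡ (trans (Δ 2) (cong (_+ 0) occ₂))
    occ₂′ : occ κ′ 2 ≡ 2 + k
    occ₂′ = suc-injective (+1≡+0⇒suc≡ (trans (Δ 0) (cong (_+ 0) occ₀)))

  μ₀-colouring-split : ∀ κ → T (isColouring? μ₀ κ) →
                       T (colouring? μ₀ 2 0 κ) ⊎ T (colouring? μ₀ 2 1 κ)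
  μ₀-colouring-split κ t = by-leg-colour (entry κ m) refl (entry-< κ m<d)
    where
    c = Equivalence.to (T-isColouring? μ₀ κ) t
    open IsColouring c
    u≡2 : entry κ 0 ≡ 2
    u≡2 = u-has-colour-2 κ isProper (proj₁ (Equivalence.to (content₃ κ) content≡))
                              (proj₁ (proj₂ (Equivalence.to (content₃ κ) content≡)))
    colouring : ∀ {b} → entry κ m ≡ b → T (colouring? μ₀ 2 b κ)
    colouring leg≡b = Equivalence.from (T-colouring? μ₀ 2 _ κ)
      record { isColouring = c ; u-colour≡ = u≡2 ; leg-colour≡ = leg≡b }
    by-leg-colour : ∀ b → entry κ m ≡ b → b < 3 → T (colouring? μ₀ 2 0 κ) ⊎ T (colouring? μ₀ 2 1 κ)
    by-leg-colour 0 leg≡0 _ = inj₁ (colouring leg≡0)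
    by-leg-colour 1 leg≡1 _ = inj₂ (colouring leg≡1)
    by-leg-colour 2 leg≡2 _ = contradiction (trans u≡2 (sym leg≡2)) (isProper 0<d m<d (leg ≤-refl))
    by-leg-colour (suc (suc (suc b))) _ (s<s (s<s (s<s ())))

  classes-disjoint : ∀ χ x y → 𝟙 (χ ∧ (x ≡ᵇ 1) ∧ (y ≡ᵇ 0)) + 𝟙 (χ ∧ (x ≡ᵇ 2) ∧ (y ≡ᵇ 0))
                               + 𝟙 (χ ∧ (x ≡ᵇ 2) ∧ (y ≡ᵇ 1)) ≤ 𝟙 χ
  classes-disjoint false _ _ = z≤n
  classes-disjoint true  0 _ = z≤n
  classes-disjoint true  1 0 = ≤-refl
  classes-disjoint true  1 (suc _) = z≤n
  classes-disjoint true  2 0 = ≤-refl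
  classes-disjoint true  2 1 = ≤-refl
  classes-disjoint true  2 (suc (suc _)) = z≤n
  classes-disjoint true  (suc (suc (suc _))) _ = z≤n

  m≡3+t*2 : m ≡ 3 + t * 2
  m≡3+t*2 = trans m≡ (cong (2 +_) (+-comm (t * 2) 1))

  -- u u₁ u₂ … u_{2n-2} coloured 2 0 1 (2 0)ⁿ⁻², the legs 1ⁿ⁻² 0 0.
  cycleColours : Vec (Fin 3) (3 + t * 2)
  cycleColours = 2F ∷ 0F ∷ 1F ∷ alternating t

  legColours : Vec (Fin 3) (t + 2)
  legColours = ones-then-00 t

  witness-length : 3 + t * 2 + (t + 2) ≡ d
  witness-length = lemma k
    where
    lemma : ∀ k → 3 + suc k * 2 + (suc k + 2) ≡ suc (suc (k + suc (suc (suc (k + 0))))) + suc (suc (suc k))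
    lemma = solve-∀

  witness : Vec (Fin 3) d
  witness = Vec.cast witness-length (cycleColours Vec.++ legColours)

  witness-cycle : ∀ {p} → p < m → entry witness p ≡ entry cycleColours p
  witness-cycle {p} p<m =
    trans (entry-cast witness-length (cycleColours Vec.++ legColours) p)
          (entry-++ˡ cycleColours legColours (subst (p <_) m≡3+t*2 p<m))

  witness-leg : ∀ i → entry witness (m + i) ≡ entry legColours i
  witness-leg i = trans (entry-cast witness-length (cycleColours Vec.++ legColours) (m + i))
    (subst (λ a → entry (cycleColours Vec.++ legColours) (a + i) ≡ entry legColours i) (sym m≡3+t*2)
           (entry-++ʳ cycleColours legColours i))

  cycle-distinct : ∀ {p} → suc p < 3 + t * 2 → entry cycleColours p ≢ entry cycleColours (suc p)
  cycle-distinct {0}                 _                      = λ ()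
  cycle-distinct {1}                 _                      = λ ()
  cycle-distinct {2}                 _                      = λ ()
  cycle-distinct {suc (suc (suc p))} (s<s (s<s (s<s sp<2t))) = alternating-distinct t sp<2t

  witness-proper : ProperSquid n witness
  witness-proper x<d y<d (step {x} sx<m) =
    subst₂ _≢_ (sym (witness-cycle (<-trans (n<1+n _) sx<m))) (sym (witness-cycle sx<m))
               (cycle-distinct (subst (suc x <_) m≡3+t*2 sx<m))
  witness-proper x<d y<d close eq = 2≢0 (begin
    2                                 ≡⟨ eq ⟩
    entry witness (m ∸ 1)             ≡⟨ witness-cycle m∸1<m ⟩
    entry cycleColours (m ∸ 1)        ≡⟨ cong (entry cycleColours) m∸1≡ ⟩
    entry cycleColours (2 + (t * 2 + 0)) ≡⟨ cong (λ p → entry cycleColours (2 + p)) (+-identityʳ (t * 2)) ⟩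
    entry cycleColours (2 + t * 2)    ≡⟨ alternating-last k ⟩
    0                                 ∎)
    where
    open ≡-Reasoning
    2≢0 : 2 ≢ 0
    2≢0 ()
  witness-proper x<d y<d (leg {y} m≤y) eq = ones-then-00≢2 t (y ∸ m) (begin
    entry legColours (y ∸ m)  ≡⟨ witness-leg (y ∸ m) ⟨
    entry witness (m + (y ∸ m)) ≡⟨ cong (entry witness) (m+[n∸m]≡n m≤y) ⟩
    entry witness y           ≡⟨ eq ⟨
    2                         ∎)
    where open ≡-Reasoning

  occ-witness : ∀ c → occ witness c ≡
    𝟙 (2 ≡ᵇ c) + (𝟙 (0 ≡ᵇ c) + (𝟙 (1 ≡ᵇ c) + t * (𝟙 (2 ≡ᵇ c) + 𝟙 (0 ≡ᵇ c))))
    + (t * 𝟙 (1 ≡ᵇ c) + (𝟙 (0 ≡ᵇ c) + (𝟙 (0 ≡ᵇ c) + 0)))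
  occ-witness c = begin
    occ witness c                          ≡⟨ occ-cast witness-length (cycleColours Vec.++ legColours) c ⟩
    occ (cycleColours Vec.++ legColours) c ≡⟨ occ-++ cycleColours legColours c ⟩
    occ cycleColours c + occ legColours c  ≡⟨ cong₂ _+_ cycle legs ⟩
    _                                      ∎
    where
    open ≡-Reasoning
    cycle = cong (λ s → 𝟙 (2 ≡ᵇ c) + (𝟙 (0 ≡ᵇ c) + (𝟙 (1 ≡ᵇ c) + s))) (occ-alternating t c)
    legs = trans (occ-++ (Vec.replicate t 1F) (0F ∷ 0F ∷ []) c)
                 (cong (_+ occ {3} (0F ∷ 0F ∷ []) c) (occ-replicate t 1F c))

  witness-colouring : Colouring μ₁ 2 1 witness
  witness-colouring = record
    { isColouring = record
      { isProper = witness-proper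
      ; content≡ = Equivalence.from (content₃ witness)
          (trans (occ-witness 0) (occ₀ k) , trans (occ-witness 1) (occ₁ k) , trans (occ-witness 2) (occ₂ k)) }
    ; u-colour≡   = refl
    ; leg-colour≡ = trans (cong (entry witness) (sym (+-identityʳ m))) (witness-leg 0) }
    where
    occ₀ : ∀ k → 0 + (1 + (0 + suc k * (0 + 1))) + (suc k * 0 + (1 + (1 + 0))) ≡ 4 + k
    occ₀ = solve-∀
    occ₁ : ∀ k → 0 + (0 + (1 + suc k * (0 + 0))) + (suc k * 1 + (0 + (0 + 0))) ≡ 2 + k
    occ₁ = solve-∀
    occ₂ : ∀ k → 1 + (0 + (0 + suc k * (1 + 0))) + (suc k * 0 + (0 + (0 + 0))) ≡ 2 + k
    occ₂ = solve-∀

  #_ : (Vec (Fin 3) d → Bool) → ℕ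
  # P = Σʷ 3 d (𝟙 ∘ P)

  coeffM-μ₀<coeffM-μ₁ : coeffM (squid n) μ₀-partition < coeffM (squid n) μ₁-partition
  coeffM-μ₀<coeffM-μ₁ = begin-strict
    # isColouring? μ₀                        ≤⟨ Σʷ-mono 3 d (λ κ → 𝟙-⊎ (μ₀-colouring-split κ)) ⟩
    Σʷ 3 d (λ κ → 𝟙 (J₀ κ) + 𝟙 (J₁ κ))     ≡⟨ Σʷ-+ 3 d (𝟙 ∘ J₀) (𝟙 ∘ J₁) ⟩
    # J₀ + # J₁
      ≤⟨ +-mono-≤ (Σʷ-injection 3 d rotateOffLeg (λ κ → ⇐ ∘ rotateOffLeg-colouring κ ∘ ⇒))
                  (Σʷ-injection 3 d swapLeg (λ κ → ⇐ ∘ swapLeg-colouring κ ∘ ⇒)) ⟩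
    # K₁ + # K₂                              ≡⟨ +-identityʳ _ ⟨
    # K₁ + # K₂ + 0
      <⟨ +-monoʳ-< (# K₁ + # K₂)
                   (≤-trans (𝟙-mono {true} (λ _ → ⇐ witness-colouring)) (≤-Σʷ 3 d (𝟙 ∘ K₃) witness)) ⟩
    # K₁ + # K₂ + # K₃                       ≡⟨ cong (_+ # K₃) (Σʷ-+ 3 d (𝟙 ∘ K₁) (𝟙 ∘ K₂)) ⟨
    Σʷ 3 d (λ κ → 𝟙 (K₁ κ) + 𝟙 (K₂ κ)) + # K₃ ≡⟨ Σʷ-+ 3 d _ (𝟙 ∘ K₃) ⟨
    Σʷ 3 d (λ κ → 𝟙 (K₁ κ) + 𝟙 (K₂ κ) + 𝟙 (K₃ κ))
      ≤⟨ Σʷ-mono 3 d (λ κ → classes-disjoint (isColouring? μ₁ κ) (entry κ 0) (entry κ m)) ⟩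
    # isColouring? μ₁                        ∎
    where
    open ≤-Reasoning
    J₀ J₁ K₁ K₂ K₃ : Vec (Fin 3) d → Bool
    J₀ = colouring? μ₀ 2 0
    J₁ = colouring? μ₀ 2 1
    K₁ = colouring? μ₁ 1 0
    K₂ = colouring? μ₁ 2 0
    K₃ = colouring? μ₁ 2 1
    ⇒ : ∀ {α a b κ} → T (colouring? α a b κ) → Colouring α a b κ
    ⇒ = Equivalence.to (T-colouring? _ _ _ _)
    ⇐ : ∀ {α a b κ} → Colouring α a b κ → T (colouring? α a b κ)
    ⇐ = Equivalence.from (T-colouring? _ _ _ _)

theorem4p1 : (n : ℕ) → 3 ≤ n →
    ¬ StronglyNice (squid n) × ¬ SchurPositive (squid n)
theorem4p1 (suc (suc (suc k))) (s≤s (s≤s (s≤s _))) = not-nice , not-positive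
  where
  open Squid k
  not-nice : ¬ StronglyNice (squid n)
  not-nice nice = <⇒≱ coeffM-μ₀<coeffM-μ₁ (nice μ₀-partition μ₁-partition μ₀⊴μ₁)
  not-positive : ¬ SchurPositive (squid n)
  not-positive positive = <⇒≱ coeffM-μ₀<coeffM-μ₁
    (schurPositive-mono (squid n) positive μ₁-partition μ₀-partition
       (λ λ′ → kostka-raise λ′ μ₁-partition μ₀-partition refl refl))
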